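{- For every large free wedge there exists a finite deterministic automaton that explores it using three pebbles.
   Context: The oriented grid $\mathbb{Z}\times\mathbb{Z}$ is embedded in the plane (nodes at integer points, edges between nodes at distance 1); nodes are anonymous and every node has ports $N,E,S,W$ pointing North, East, South, West. Given two half-lines $H_1,H_2$ in the plane with a common origin $O$ (arbitrary real directions), let $W(H_1,H_2)$ be the closed region swept clockwise from $H_1$ to $H_2$ (half-lines included); the wedge is the subgraph of the grid induced by the grid nodes in $W(H_1,H_2)$. It is large if the clockwise angle $\alpha$ from $H_1$ to $H_2$ satisfies $\pi\le\alpha\le2\pi$. A wedge is free if both boundaries are free, i.e., all ports at all nodes are free and the agent moves in the whole grid unrestricted, but must visit all nodes of the wedge; for free wedges the origin $O$ is the starting node of the agent. The agent is a finite deterministic (Mealy) automaton carrying $p$ pebbles: at each step it sees whether a pebble lies on the current node and how many pebbles it carries; depending on its state and this input it moves through a port, possibly dropping a pebble on the empty current node (if it carries one) or picking up the pebble lying there, and changes state. It starts in its initial state with all $p$ pebbles, with no pebbles on the grid. The automaton explores the wedge if every node of the wedge is eventually visited. -}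

module Defs where

open import Level using (Level; 0ℓ) renaming (suc to lsuc)
open import Data.Nat as ℕ using (ℕ; zero; suc)
open import Data.Integer as ℤ using (ℤ; +_; -[1+_]; +[1+_]; 0ℤ; 1ℤ)
open import Data.Rational.Unnormalised as ℚ using (ℚᵘ; mkℚᵘ)
open import Data.Fin as Fin using (Fin; zero; suc; toℕ; fromℕ<; inject₁)
open import Data.Bool using (Bool; true; false; if_then_else_)
open import Data.Product using (Σ; ∃; _×_; _,_; proj₁; proj₂)
open import Data.Sum using (_⊎_)
open import Data.Empty using (⊥)
open import Data.Unit using (⊤)
open import Relation.Nullary using (¬_; yes; no)
open import Relation.Binary.PropositionalEquality using (_≡_)

-- Real numbers as (two-sided) Dedekind cuts of ℚᵘ.
-- L q  means  q < x ,   U q  means  x < q.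
-- (mkℚᵘ n d denotes the rational n / (d+1).)

record ℝ : Set₁ where
  field
    L U      : ℚᵘ → Set
    L-inhab  : ∃ λ q → L q
    U-inhab  : ∃ λ q → U q
    L-lower  : ∀ q r → q ℚ.< r → L r → L q
    L-open   : ∀ q → L q → ∃ λ r → q ℚ.< r × L r
    U-upper  : ∀ q r → q ℚ.< r → U q → U r
    U-open   : ∀ r → U r → ∃ λ q → q ℚ.< r × U q
    disjoint : ∀ q → L q → U q → ⊥
    located  : ∀ q r → q ℚ.< r → L q ⊎ U r
open ℝ public

_<ᵣ_ : ℝ → ℝ → Set
x <ᵣ y = ∃ λ q → U x q × L y q

_≤ᵣ_ : ℝ → ℝ → Set
x ≤ᵣ y = ¬ (y <ᵣ x)

-- s + t ≤ 0  (i.e. ¬ (0 < s + t), where 0 < s + t iff ∃ q. -q < s and q < t)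
sumNonPos : ℝ → ℝ → Set
sumNonPos s t = ¬ (∃ λ q → L s (ℚ.- q) × L t q)

-- 0 ≤ s + t  (i.e. ¬ (s + t < 0), where s + t < 0 iff ∃ q. t < q and s < -q)
sumNonNeg : ℝ → ℝ → Set
sumNonNeg s t = ¬ (∃ λ q → U t q × U s (ℚ.- q))

-- comparisons  t * a > b  and  t * a < b  for a real t and integers a, b
gtMul : ℝ → ℤ → ℤ → Set
gtMul t +[1+ n ] b = L t (mkℚᵘ b n)
gtMul t (+ 0)    b = b ℤ.< 0ℤ
gtMul t -[1+ n ] b = U t (mkℚᵘ (ℤ.- b) n)

ltMul : ℝ → ℤ → ℤ → Set
ltMul t +[1+ n ] b = U t (mkℚᵘ b n)
ltMul t (+ 0)    b = 0ℤ ℤ.< b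
ltMul t -[1+ n ] b = L t (mkℚᵘ (ℤ.- b) n)

-- Directions of half-lines in the plane (y axis pointing North).
-- right t : direction of the vector ( 1 , t)
-- left  t : direction of the vector (-1 , t)
-- up      : direction of ( 0 , 1)
-- down    : direction of ( 0 ,-1)
-- Every direction of ℝ² is represented (exactly once up to equality of reals).

data Direction : Set₁ where
  right : ℝ → Direction
  left  : ℝ → Direction
  up    : Direction
  down  : Direction

-- For a direction d and an integer vector v = (a , b), with
-- cross (x₁,y₁) (x₂,y₂) = x₁ y₂ - y₁ x₂ :
-- CrossNeg d v  ⇔  cross d v < 0   (v strictly clockwise of d, within π)
-- CrossPos d v  ⇔  cross d v > 0   (v strictly counterclockwise of d, within π)

CrossNeg : Direction → ℤ × ℤ → Set
CrossNeg (right t) (a , b) = gtMul t a b             -- b - t a < 0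
CrossNeg (left t)  (a , b) = gtMul t a (ℤ.- b)       -- -b - t a < 0
CrossNeg up        (a , b) = 0ℤ ℤ.< a
CrossNeg down      (a , b) = a ℤ.< 0ℤ

CrossPos : Direction → ℤ × ℤ → Set
CrossPos (right t) (a , b) = ltMul t a b
CrossPos (left t)  (a , b) = ltMul t a (ℤ.- b)
CrossPos up        (a , b) = a ℤ.< 0ℤ
CrossPos down      (a , b) = 0ℤ ℤ.< a

-- Large d₁ d₂ : the clockwise angle α from H₁ (direction d₁) to H₂
-- (direction d₂) satisfies π ≤ α ≤ 2π, i.e. the clockwise angle 2π - α from
-- d₂ to d₁ lies in [0, π], i.e.  cross d₂ d₁ ≤ 0.
-- (When d₁ = d₂ the wedge is read as the whole plane, α = 2π.)
-- CrossNonPos e d ⇔ cross e d ≤ 0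
CrossNonPos : Direction → Direction → Set
CrossNonPos (right s) (right t) = t ≤ᵣ s
CrossNonPos (right s) (left t)  = sumNonPos s t
CrossNonPos (right s) up        = ⊥
CrossNonPos (right s) down      = ⊤
CrossNonPos (left s)  (right t) = sumNonNeg s t
CrossNonPos (left s)  (left t)  = s ≤ᵣ t
CrossNonPos (left s)  up        = ⊤
CrossNonPos (left s)  down      = ⊥
CrossNonPos up        (right t) = ⊤
CrossNonPos up        (left t)  = ⊥
CrossNonPos up        up        = ⊤
CrossNonPos up        down      = ⊤
CrossNonPos down      (right t) = ⊥
CrossNonPos down      (left t)  = ⊤
CrossNonPos down      up        = ⊤
CrossNonPos down      down      = ⊤

Large : Direction → Direction → Set
Large d₁ d₂ = CrossNonPos d₂ d₁

-- Nodes of the wedge W(H₁,H₂) with origin O (an integer point), for a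
-- LARGE wedge: exactly the points NOT in the open sector swept clockwise
-- from H₂ to H₁ (which has angle ≤ π), i.e. not (v - O strictly clockwise
-- of d₂ and d₁ strictly clockwise of v - O).
Node : Set
Node = ℤ × ℤ

_-ᴺ_ : Node → Node → Node
(x , y) -ᴺ (x' , y') = (x ℤ.- x' , y ℤ.- y')

InLargeWedge : Node → Direction → Direction → Node → Set
InLargeWedge O d₁ d₂ v = ¬ (CrossNeg d₂ (v -ᴺ O) × CrossPos d₁ (v -ᴺ O))

data Port : Set where
  N E S W : Port

move : Port → Node → Node
move N (x , y) = (x , y ℤ.+ 1ℤ)
move E (x , y) = (x ℤ.+ 1ℤ , y)
move S (x , y) = (x , y ℤ.- 1ℤ)
move W (x , y) = (x ℤ.- 1ℤ , y)

data Action : Set where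
  none drop pick : Action

-- Input: whether a pebble lies on the current node, and the number of
-- carried pebbles (0..p).
record Automaton (p : ℕ) : Set where
  field
    nStates : ℕ
    init    : Fin nStates
    δ       : Fin nStates → Bool → Fin (suc p) → Fin nStates × Port × Action
open Automaton public

record Config {p : ℕ} (A : Automaton p) : Set where
  constructor cfg
  field
    pos     : Node
    state   : Fin (nStates A)
    board   : Node → Bool
    carried : Fin (suc p)
open Config public

updateBoard : (Node → Bool) → Node → Bool → Node → Bool
updateBoard f u b w with proj₁ w ℤ.≟ proj₁ u | proj₂ w ℤ.≟ proj₂ u
... | yes _ | yes _ = b
... | _     | _     = f w

-- carried + 1 (the cap at p is never reached in actual runs)
incr : ∀ {p} → Fin (suc p) → Fin (suc p)
incr {p} c with suc (toℕ c) ℕ.<? suc p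
... | yes lt = fromℕ< lt
... | no  _  = c

-- apply the pebble action at the current node; an action that is not
-- possible (dropping onto an occupied node or with no pebble carried,
-- picking on an empty node) has no effect.
applyAction : ∀ {p} → Action → Node → (Node → Bool) → Fin (suc p)
            → (Node → Bool) × Fin (suc p)
applyAction none u f c = f , c
applyAction drop u f zero    = f , zero
applyAction drop u f (suc c) =
  if f u then (f , suc c) else (updateBoard f u true , inject₁ c)
applyAction pick u f c =
  if f u then (updateBoard f u false , incr c) else (f , c)

step : ∀ {p} (A : Automaton p) → Config A → Config A
step A (cfg u q f c) with δ A q (f u) c
... | (q' , port , act) with applyAction act u f c
...   | (f' , c') = cfg (move port u) q' f' c'

initConfig : ∀ {p} (A : Automaton p) → Node → Config A
initConfig {p} A O = cfg O (init A) (λ _ → false) (Fin.fromℕ p)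

run : ∀ {p} (A : Automaton p) → Node → ℕ → Config A
run A O zero    = initConfig A O
run A O (suc n) = step A (run A O n)

Visits : ∀ {p} (A : Automaton p) → Node → Node → Set
Visits A O v = ∃ λ n → pos (run A O n) ≡ v

ExploresLargeFreeWedge : ∀ {p} → Automaton p → Node → Direction → Direction → Set
ExploresLargeFreeWedge A O d₁ d₂ = ∀ v → InLargeWedge O d₁ d₂ v → Visits A O v

{-# OPTIONS --safe #-}
-- The automaton explores the whole plane, so it explores every wedge, whatever
-- its directions.  Relative to the start O it keeps its three pebbles on the
-- corners R = (s,0), U = (0,s), V = (−s,−s) of a triangle and walks around it:
-- from R to U by stairs (−1,1), from U to V by stairs (−1,−2) and from V to R by
-- stairs (2,1), checking for a pebble after each stair.  At each corner it
-- carries the pebble found there one unit outward, so the next lap runs around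
-- the triangle of size s + 1.  The boundaries of these nested triangles cover
-- the plane.
module Submission where

open import Defs hiding (U)
open import Algebra.Bundles using (AbelianGroup)
open import Data.Bool using (Bool; true; false)
open import Data.Fin using (Fin; zero; suc; inject₁)
open import Data.Integer as ℤ using (ℤ; +_; -[1+_]; 0ℤ; 1ℤ)
import Data.Integer.Properties as ℤP
open import Data.Integer.Tactic.RingSolver using (solve-∀)
open import Data.List using (List; []; _∷_; _++_; [_])
open import Data.List.Relation.Unary.All using (All; []; _∷_)
open import Data.Nat as ℕ using (ℕ; zero; suc; _≤_; _<_; s≤s)
import Data.Nat.Properties as ℕP
open import Data.Product using (Σ; ∃-syntax; _×_; _,_; proj₁; proj₂)
open import Data.Product.Properties using (≡-dec)
open import Function using (_∘_; _|>′_)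
open import Relation.Binary.Definitions using (DecidableEquality)
open import Relation.Binary.PropositionalEquality hiding ([_])
open import Relation.Nullary using (yes; no; contradiction)
open import Algebra.Properties.Group (AbelianGroup.group ℤP.+-0-abelianGroup)
  using (∙-cancelˡ)

_≟ᴺ_ : DecidableEquality Node
_≟ᴺ_ = ≡-dec ℤ._≟_ ℤ._≟_

updateBoard-same : ∀ f u b → updateBoard f u b u ≡ b
updateBoard-same f (x , y) b with x ℤ.≟ x | y ℤ.≟ y
... | yes _  | yes _  = refl
... | no x≢x | _      = contradiction refl x≢x
... | yes _  | no y≢y = contradiction refl y≢y

updateBoard-other : ∀ f u b {w} → w ≢ u → updateBoard f u b w ≡ f w
updateBoard-other f (x′ , y′) b {x , y} w≢u with x ℤ.≟ x′ | y ℤ.≟ y′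
... | yes refl | yes refl = contradiction refl w≢u
... | no _     | _        = refl
... | yes _    | no _     = refl

updateBoard-cong : ∀ f g u b {w} → f w ≡ g w → updateBoard f u b w ≡ updateBoard g u b w
updateBoard-cong f g u b {w} fw≡gw with proj₁ w ℤ.≟ proj₁ u | proj₂ w ℤ.≟ proj₂ u
... | yes _ | yes _ = refl
... | no _  | _     = fw≡gw
... | yes _ | no _  = fw≡gw

-- Pebbles are listed from the most recently dropped; the automaton always picks
-- up the oldest one, the last of the list.
pebbles : List Node → Node → Bool
pebbles []       = λ _ → false
pebbles (u ∷ us) = updateBoard (pebbles us) u true

pebbles-∉ : ∀ {w} ps → All (w ≢_) ps → pebbles ps w ≡ false
pebbles-∉ []       []            = refl
pebbles-∉ (u ∷ ps) (w≢u ∷ w∉ps) =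
  trans (updateBoard-other _ u true w≢u) (pebbles-∉ ps w∉ps)

pebbles-last : ∀ ps u → pebbles (ps ++ [ u ]) u ≡ true
pebbles-last []       u = updateBoard-same _ u true
pebbles-last (a ∷ ps) u with u ≟ᴺ a
... | yes refl = updateBoard-same _ u true
... | no u≢a   = trans (updateBoard-other _ a true u≢a) (pebbles-last ps u)

pebbles-++-other : ∀ ps {u w} → w ≢ u → pebbles (ps ++ [ u ]) w ≡ pebbles ps w
pebbles-++-other []       w≢u = updateBoard-other _ _ true w≢u
pebbles-++-other (a ∷ ps) {u} {w} w≢u =
  updateBoard-cong (pebbles (ps ++ [ u ])) (pebbles ps) a true {w} (pebbles-++-other ps w≢u)

pebbles-pick-last : ∀ ps u → All (u ≢_) ps →
                    updateBoard (pebbles (ps ++ [ u ])) u false ≗ pebbles ps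
pebbles-pick-last ps u u∉ps w with w ≟ᴺ u
... | yes refl = trans (updateBoard-same _ w false) (sym (pebbles-∉ ps u∉ps))
... | no w≢u   = trans (updateBoard-other _ u false w≢u) (pebbles-++-other ps w≢u)

State : Set
State = Fin 20

pattern start₀ = zero
pattern start₁ = suc start₀
pattern start₂ = suc start₁
pattern start₃ = suc start₂
pattern start₄ = suc start₃
pattern start₅ = suc start₄
pattern start₆ = suc start₅
pattern placeR = suc start₆
pattern up₁    = suc placeR
pattern check₁ = suc up₁
pattern pushU  = suc check₁
pattern check₂ = suc pushU
pattern down₂  = suc check₂
pattern down₂′ = suc down₂
pattern pushV₁ = suc down₂′
pattern pushV₂ = suc pushV₁
pattern pushV₃ = suc pushV₂
pattern check₃ = suc pushV₃
pattern east₃  = suc check₃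
pattern north₃ = suc east₃

transition : State → Bool → State × Port × Action
transition start₀ _     = start₁ , N , none
transition start₁ _     = start₂ , S , drop
transition start₂ _     = start₃ , S , none
transition start₃ _     = start₄ , W , none
transition start₄ _     = start₅ , E , drop
transition start₅ _     = start₆ , N , none
transition start₆ _     = placeR , E , none
transition placeR _     = up₁    , W , drop
transition up₁    _     = check₁ , N , none
transition check₁ false = up₁    , W , none
transition check₁ true  = pushU  , N , pick
transition pushU  _     = check₂ , S , drop
transition check₂ false = down₂  , W , none
transition check₂ true  = pushV₁ , S , pick
transition down₂  _     = down₂′ , S , none
transition down₂′ _     = check₂ , S , none
transition pushV₁ _     = pushV₂ , W , none
transition pushV₂ _     = pushV₃ , E , drop
transition pushV₃ _     = check₃ , N , none
transition check₃ false = east₃  , E , none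
transition check₃ true  = placeR , E , pick
transition east₃  _     = north₃ , E , none
transition north₃ _     = check₃ , N , none

explorer : Automaton 3
explorer = record { nStates = 20 ; init = start₀ ; δ = λ q b _ → transition q b }

step-none : ∀ {u q f k q′ p} → transition q (f u) ≡ (q′ , p , none) →
            step explorer (cfg u q f k) ≡ cfg (move p u) q′ f k
step-none t rewrite t = refl

step-drop : ∀ {u q f k q′ p} → f u ≡ false → transition q false ≡ (q′ , p , drop) →
            step explorer (cfg u q f (suc k))
              ≡ cfg (move p u) q′ (updateBoard f u true) (inject₁ k)
step-drop fu t rewrite fu | t | fu = refl

step-pick : ∀ {u q f k q′ p} → f u ≡ true → transition q true ≡ (q′ , p , pick) →
            step explorer (cfg u q f k)
              ≡ cfg (move p u) q′ (updateBoard f u false) (incr k)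
step-pick fu t rewrite fu | t | fu = refl

module _ (O : Node) where

  Visited : Node → Set
  Visited = Visits explorer O

  -- Boards are compared pointwise: the run builds them by nested updateBoard,
  -- and equality of functions is not available.
  record At (n : ℕ) (u : Node) (q : State) (g : Node → Bool) (k : Fin 4) : Set where
    constructor mkAt
    field
      board  : Node → Bool
      run≡   : run explorer O n ≡ cfg u q board k
      board≗ : board ≗ g

  Reaches : Node → State → (Node → Bool) → Fin 4 → Set
  Reaches u q g k = ∃[ n ] At n u q g k

  At-moved : ∀ {n u u′ q g k} → u ≡ u′ → At n u q g k → At n u′ q g k
  At-moved refl a = a

  visited : ∀ {n u q g k} → At n u q g k → Visited u
  visited {n} (mkAt _ run≡ _) = n , cong pos run≡

  reached : ∀ {u q g k} → Reaches u q g k → Visited u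
  reached (_ , a) = visited a

  none-step : ∀ {n u q g k q′ p u′} → transition q (g u) ≡ (q′ , p , none) →
              move p u ≡ u′ → At n u q g k → At (suc n) u′ q′ g k
  none-step {u = u} {q} t refl (mkAt f run≡ f≗g) =
    mkAt f (trans (cong (step explorer) run≡)
                  (step-none (trans (cong (transition q) (f≗g u)) t)))
           f≗g

  drop-step : ∀ {n u q ps k q′ p u′} → All (u ≢_) ps →
              transition q false ≡ (q′ , p , drop) →
              move p u ≡ u′ → At n u q (pebbles ps) (suc k) →
              At (suc n) u′ q′ (pebbles (u ∷ ps)) (inject₁ k)
  drop-step {u = u} {ps = ps} u∉ps t refl (mkAt f run≡ f≗g) =
    mkAt _ (trans (cong (step explorer) run≡)
                  (step-drop (trans (f≗g u) (pebbles-∉ ps u∉ps)) t))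
           (λ w → updateBoard-cong f (pebbles ps) u true {w} (f≗g w))

  pick-step : ∀ {n u q ps k q′ p u′} → All (u ≢_) ps →
              transition q true ≡ (q′ , p , pick) →
              move p u ≡ u′ → At n u q (pebbles (ps ++ [ u ])) k →
              At (suc n) u′ q′ (pebbles ps) (incr k)
  pick-step {u = u} {ps = ps} u∉ps t refl (mkAt f run≡ f≗g) =
    mkAt _ (trans (cong (step explorer) run≡)
                  (step-pick (trans (f≗g u) (pebbles-last ps u)) t))
           (λ w → trans (updateBoard-cong f (pebbles (ps ++ [ u ])) u false {w} (f≗g w))
                        (pebbles-pick-last ps u u∉ps w))

  walk : ∀ {q g k} (p : ℕ → Node) →
         (∀ {n j} → At n (p j) q g k → g (p j) ≡ false → Reaches (p (suc j)) q g k) →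
         ∀ {n} len → At n (p 0) q g k → (∀ j → j < len → g (p j) ≡ false) →
         ∀ j → j ≤ len → Reaches (p j) q g k
  walk p advance len a free zero    _     = _ , a
  walk p advance len a free (suc j) j<len =
    advance (proj₂ (walk p advance len a free j (ℕP.<⇒≤ j<len))) (free j j<len)

  pt : ℤ → ℤ → Node
  pt a b = (proj₁ O ℤ.+ a , proj₂ O ℤ.+ b)

  pt-origin : pt 0ℤ 0ℤ ≡ O
  pt-origin = cong₂ _,_ (ℤP.+-identityʳ _) (ℤP.+-identityʳ _)

  pt-injective : ∀ {a b a′ b′} → pt a b ≡ pt a′ b′ → a ≡ a′ × b ≡ b′
  pt-injective {a} {b} {a′} {b′} e =
    ∙-cancelˡ (proj₁ O) a a′ (cong proj₁ e) ,
    ∙-cancelˡ (proj₂ O) b b′ (cong proj₂ e)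

  pt-≢ˣ : ∀ {a b a′ b′} → a ≢ a′ → pt a b ≢ pt a′ b′
  pt-≢ˣ a≢a′ e = a≢a′ (proj₁ (pt-injective e))

  pt-≢ʸ : ∀ {a b a′ b′} → b ≢ b′ → pt a b ≢ pt a′ b′
  pt-≢ʸ b≢b′ e = b≢b′ (proj₂ (pt-injective e))

  move-N : ∀ a b → move N (pt a b) ≡ pt a (b ℤ.+ 1ℤ)
  move-N a b = cong (_ ,_) (ℤP.+-assoc (proj₂ O) b 1ℤ)

  move-S : ∀ a b → move S (pt a b) ≡ pt a (b ℤ.- 1ℤ)
  move-S a b = cong (_ ,_) (ℤP.+-assoc (proj₂ O) b (ℤ.- 1ℤ))

  move-E : ∀ a b → move E (pt a b) ≡ pt (a ℤ.+ 1ℤ) b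
  move-E a b = cong (_, _) (ℤP.+-assoc (proj₁ O) a 1ℤ)

  move-W : ∀ a b → move W (pt a b) ≡ pt (a ℤ.- 1ℤ) b
  move-W a b = cong (_, _) (ℤP.+-assoc (proj₁ O) a (ℤ.- 1ℤ))

  R U V : ℕ → Node
  R s = pt (+ s) 0ℤ
  U s = pt 0ℤ (+ s)
  V s = pt (ℤ.- + s) (ℤ.- + s)

  side₁ side₂ side₃ : ℕ → ℕ → Node
  side₁ s j = pt (+ s ℤ.- + j) (+ j)
  side₂ s j = pt (ℤ.- + j) (+ s ℤ.- + 2 ℤ.* + j)
  side₃ s j = pt (+ 2 ℤ.* + j ℤ.- + s) (+ j ℤ.- + s)

  side₁-start : ∀ s → side₁ s 0 ≡ R s
  side₁-start s = cong (λ x → pt x 0ℤ) (ℤP.+-identityʳ (+ s))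

  side₁-end : ∀ s → side₁ s s ≡ U s
  side₁-end s = cong (λ x → pt x (+ s)) (ℤP.+-inverseʳ (+ s))

  side₁-suc : ∀ s j → move N (move W (side₁ s j)) ≡ side₁ s (suc j)
  side₁-suc s j = trans (cong (move N) (move-W _ _))
                 (trans (move-N _ _) (cong₂ pt (x≡ (+ s) (+ j)) (ℤP.+-comm (+ j) 1ℤ)))
    where
    x≡ : ∀ S J → S ℤ.- J ℤ.- 1ℤ ≡ S ℤ.- (1ℤ ℤ.+ J)
    x≡ = solve-∀

  side₂-start : ∀ s → side₂ s 0 ≡ U s
  side₂-start s = cong (pt 0ℤ) (ℤP.+-identityʳ (+ s))

  side₂-end : ∀ s → side₂ s s ≡ V s
  side₂-end s = cong (pt _) (y≡ (+ s))
    where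
    y≡ : ∀ S → S ℤ.- + 2 ℤ.* S ≡ ℤ.- S
    y≡ = solve-∀

  side₂-suc : ∀ s j → move S (move S (move W (side₂ s j))) ≡ side₂ s (suc j)
  side₂-suc s j = trans (cong (move S ∘ move S) (move-W _ _))
                 (trans (cong (move S) (move-S _ _))
                 (trans (move-S _ _) (cong₂ pt (x≡ (+ j)) (y≡ (+ s) (+ j)))))
    where
    x≡ : ∀ J → ℤ.- J ℤ.- 1ℤ ≡ ℤ.- (1ℤ ℤ.+ J)
    x≡ = solve-∀
    y≡ : ∀ S J → S ℤ.- + 2 ℤ.* J ℤ.- 1ℤ ℤ.- 1ℤ ≡ S ℤ.- + 2 ℤ.* (1ℤ ℤ.+ J)
    y≡ = solve-∀

  side₃-start : ∀ s → side₃ s 0 ≡ V s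
  side₃-start s = cong₂ pt (ℤP.+-identityˡ _) (ℤP.+-identityˡ _)

  side₃-end : ∀ s → side₃ s s ≡ R s
  side₃-end s = cong₂ pt (x≡ (+ s)) (ℤP.+-inverseʳ (+ s))
    where
    x≡ : ∀ S → + 2 ℤ.* S ℤ.- S ≡ S
    x≡ = solve-∀

  side₃-suc : ∀ s j → move N (move E (move E (side₃ s j))) ≡ side₃ s (suc j)
  side₃-suc s j = trans (cong (move N ∘ move E) (move-E _ _))
                 (trans (cong (move N) (move-E _ _))
                 (trans (move-N _ _) (cong₂ pt (x≡ (+ s) (+ j)) (y≡ (+ s) (+ j)))))
    where
    x≡ : ∀ S J → + 2 ℤ.* J ℤ.- S ℤ.+ 1ℤ ℤ.+ 1ℤ ≡ + 2 ℤ.* (1ℤ ℤ.+ J) ℤ.- S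
    x≡ = solve-∀
    y≡ : ∀ S J → J ℤ.- S ℤ.+ 1ℤ ≡ (1ℤ ℤ.+ J) ℤ.- S
    y≡ = solve-∀

  R-push : ∀ s → move E (R s) ≡ R (suc s)
  R-push s = trans (move-E _ _) (cong (λ x → pt x 0ℤ) (ℤP.+-comm (+ s) 1ℤ))

  U-push : ∀ s → move N (U s) ≡ U (suc s)
  U-push s = trans (move-N _ _) (cong (pt 0ℤ) (ℤP.+-comm (+ s) 1ℤ))

  U-return : ∀ s → move S (U (suc s)) ≡ U s
  U-return s = trans (move-S _ _) (cong (pt 0ℤ) (y≡ (+ s)))
    where
    y≡ : ∀ S → 1ℤ ℤ.+ S ℤ.- 1ℤ ≡ S
    y≡ = solve-∀

  V-push : ∀ s → move W (move S (V s)) ≡ V (suc s)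
  V-push s = trans (cong (move W) (move-S _ _))
             (trans (move-W _ _) (cong₂ pt (e (+ s)) (e (+ s))))
    where
    e : ∀ S → ℤ.- S ℤ.- 1ℤ ≡ ℤ.- (1ℤ ℤ.+ S)
    e = solve-∀

  V-return : ∀ s → move N (move E (V (suc s))) ≡ V s
  V-return s = trans (cong (move N) (move-E _ _))
               (trans (move-N _ _) (cong₂ pt (e (+ s)) (e (+ s))))
    where
    e : ∀ S → ℤ.- (1ℤ ℤ.+ S) ℤ.+ 1ℤ ≡ ℤ.- S
    e = solve-∀

  advance₁ : ∀ {n s j g k} → At n (side₁ s j) check₁ g k → g (side₁ s j) ≡ false →
             Reaches (side₁ s (suc j)) check₁ g k
  advance₁ {s = s} {j} a free =
    _ , (a |>′ none-step (cong (transition check₁) free) refl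
           |>′ none-step refl (side₁-suc s j))

  advance₂ : ∀ {n s j g k} → At n (side₂ s j) check₂ g k → g (side₂ s j) ≡ false →
             Reaches (side₂ s (suc j)) check₂ g k
  advance₂ {s = s} {j} a free =
    _ , (a |>′ none-step (cong (transition check₂) free) refl
           |>′ none-step refl refl
           |>′ none-step refl (side₂-suc s j))

  advance₃ : ∀ {n s j g k} → At n (side₃ s j) check₃ g k → g (side₃ s j) ≡ false →
             Reaches (side₃ s (suc j)) check₃ g k
  advance₃ {s = s} {j} a free =
    _ , (a |>′ none-step (cong (transition check₃) free) refl
           |>′ none-step refl refl
           |>′ none-step refl (side₃-suc s j))

  side₁-lap : ∀ t {n} → let s = suc t in
              At n (R s) placeR (pebbles (V s ∷ U s ∷ [])) (suc zero) →
              Reaches (U s) check₂ (pebbles (U (suc s) ∷ R s ∷ V s ∷ [])) zero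
              × (∀ i → i ≤ s → Visited (side₁ s i))
  side₁-lap t a = pushed , covered
    where
    s : ℕ
    s = suc t
    placed : List Node
    placed = R s ∷ V s ∷ U s ∷ []
    first : Reaches (side₁ s 1) check₁ (pebbles placed) zero
    first = _ , (a |>′ drop-step (pt-≢ʸ (λ ()) ∷ pt-≢ʸ (λ ()) ∷ []) refl refl
                   |>′ none-step refl (trans (cong (move N ∘ move W) (sym (side₁-start s)))
                                             (side₁-suc s 0)))
    free : ∀ j → j < t → pebbles placed (side₁ s (suc j)) ≡ false
    free j j<t = pebbles-∉ placed (pt-≢ʸ (λ ()) ∷ pt-≢ʸ (λ ())
      ∷ pt-≢ʸ (λ e → ℕP.<-irrefl (ℕP.suc-injective (ℤP.+-injective e)) j<t) ∷ [])
    stairs : ∀ j → j ≤ t → Reaches (side₁ s (suc j)) check₁ (pebbles placed) zero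
    stairs = walk (λ j → side₁ s (suc j)) (advance₁ {s = s}) t (proj₂ first) free
    pushed : Reaches (U s) check₂ (pebbles (U (suc s) ∷ R s ∷ V s ∷ [])) zero
    pushed = _ , (proj₂ (stairs t ℕP.≤-refl)
      |>′ At-moved (side₁-end s)
      |>′ pick-step (pt-≢ˣ (λ ()) ∷ pt-≢ˣ (λ ()) ∷ []) refl (U-push s)
      |>′ drop-step (pt-≢ˣ (λ ()) ∷ pt-≢ˣ (λ ()) ∷ []) refl (U-return s))
    covered : ∀ i → i ≤ s → Visited (side₁ s i)
    covered zero    _         = subst Visited (sym (side₁-start s)) (visited a)
    covered (suc j) (s≤s j≤t) = reached (stairs j j≤t)

  side₂-lap : ∀ t {n} → let s = suc t in
              At n (U s) check₂ (pebbles (U (suc s) ∷ R s ∷ V s ∷ [])) zero →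
              Reaches (V s) check₃ (pebbles (V (suc s) ∷ U (suc s) ∷ R s ∷ [])) zero
              × (∀ i → i ≤ s → Visited (side₂ s i))
  side₂-lap t a = pushed , λ i i≤s → reached (stairs i i≤s)
    where
    s : ℕ
    s = suc t
    placed : List Node
    placed = U (suc s) ∷ R s ∷ V s ∷ []
    free : ∀ j → j < s → pebbles placed (side₂ s j) ≡ false
    free zero    _         = subst (λ u → pebbles placed u ≡ false) (sym (side₂-start s))
      (pebbles-∉ placed (pt-≢ʸ (λ e → ℕP.1+n≢n (sym (ℤP.+-injective e)))
                         ∷ pt-≢ˣ (λ ()) ∷ pt-≢ˣ (λ ()) ∷ []))
    free (suc j) (s≤s j<t) = pebbles-∉ placed (pt-≢ˣ (λ ()) ∷ pt-≢ˣ (λ ())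
      ∷ pt-≢ˣ (λ e → ℕP.<-irrefl (ℤP.-[1+-injective e) j<t) ∷ [])
    stairs : ∀ j → j ≤ s → Reaches (side₂ s j) check₂ (pebbles placed) zero
    stairs = walk (side₂ s) (advance₂ {s = s}) s (At-moved (sym (side₂-start s)) a) free
    pushed : Reaches (V s) check₃ (pebbles (V (suc s) ∷ U (suc s) ∷ R s ∷ [])) zero
    pushed = _ , (proj₂ (stairs s ℕP.≤-refl)
      |>′ At-moved (side₂-end s)
      |>′ pick-step (pt-≢ˣ (λ ()) ∷ pt-≢ˣ (λ ()) ∷ []) refl refl
      |>′ none-step refl (V-push s)
      |>′ drop-step (pt-≢ˣ (λ ()) ∷ pt-≢ˣ (λ ()) ∷ []) refl refl
      |>′ none-step refl (V-return s))

  side₃-lap : ∀ t {n} → let s = suc t in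
              At n (V s) check₃ (pebbles (V (suc s) ∷ U (suc s) ∷ R s ∷ [])) zero →
              Reaches (R (suc s)) placeR (pebbles (V (suc s) ∷ U (suc s) ∷ [])) (suc zero)
              × (∀ i → i ≤ s → Visited (side₃ s i))
  side₃-lap t a = pushed , λ i i≤s → reached (stairs i i≤s)
    where
    s : ℕ
    s = suc t
    placed : List Node
    placed = V (suc s) ∷ U (suc s) ∷ R s ∷ []
    below : ∀ J D → J ℤ.- (1ℤ ℤ.+ (J ℤ.+ D)) ≡ ℤ.- (1ℤ ℤ.+ D)
    below = solve-∀
    free : ∀ j → j < s → pebbles placed (side₃ s j) ≡ false
    free j j<s with ℕP.m≤n⇒∃[o]m+o≡n j<s
    ... | d , j+d+1≡s = subst (λ u → pebbles placed u ≡ false) (sym (cong (pt _) y≡))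
          (pebbles-∉ placed (pt-≢ʸ (λ e → ℕP.<-irrefl (ℤP.-[1+-injective e) d<s)
                             ∷ pt-≢ʸ (λ ()) ∷ pt-≢ʸ (λ ()) ∷ []))
      where
      y≡ : + j ℤ.- + s ≡ -[1+ d ]
      y≡ = trans (cong (λ m → + j ℤ.- + m) (sym j+d+1≡s)) (below (+ j) (+ d))
      d<s : d < s
      d<s = subst (d <_) j+d+1≡s (s≤s (ℕP.m≤n+m d j))
    stairs : ∀ j → j ≤ s → Reaches (side₃ s j) check₃ (pebbles placed) zero
    stairs = walk (side₃ s) (advance₃ {s = s}) s (At-moved (sym (side₃-start s)) a) free
    pushed : Reaches (R (suc s)) placeR (pebbles (V (suc s) ∷ U (suc s) ∷ [])) (suc zero)
    pushed = _ , (proj₂ (stairs s ℕP.≤-refl)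
      |>′ At-moved (side₃-end s)
      |>′ pick-step (pt-≢ʸ (λ ()) ∷ pt-≢ʸ (λ ()) ∷ []) refl (R-push s))

  Corner : ℕ → Set
  Corner s = Reaches (R s) placeR (pebbles (V s ∷ U s ∷ [])) (suc zero)

  SidesVisited : ℕ → Set
  SidesVisited s =
    ∀ i → i ≤ s → Visited (side₁ s i) × Visited (side₂ s i) × Visited (side₃ s i)

  opening : Corner 1
  opening = _ , (origin
    |>′ none-step refl (move-N _ _)
    |>′ drop-step [] refl (move-S _ _)
    |>′ none-step refl (move-S _ _)
    |>′ none-step refl (move-W _ _)
    |>′ drop-step (pt-≢ˣ (λ ()) ∷ []) refl (move-E _ _)
    |>′ none-step refl (move-N _ _)
    |>′ none-step refl (move-E _ _))
    where
    origin : At 0 (pt 0ℤ 0ℤ) start₀ (pebbles []) (suc (suc (suc zero)))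
    origin = At-moved (sym pt-origin) (mkAt _ refl (λ _ → refl))

  lap : ∀ t → Corner (suc t) → Corner (suc (suc t)) × SidesVisited (suc t)
  lap t (_ , a) =
    let (_ , a₂) , visited₁ = side₁-lap t a
        (_ , a₃) , visited₂ = side₂-lap t a₂
        next     , visited₃ = side₃-lap t a₃
    in next , λ i i≤s → visited₁ i i≤s , visited₂ i i≤s , visited₃ i i≤s

  corner : ∀ t → Corner (suc t)
  corner zero    = opening
  corner (suc t) = proj₁ (lap t (corner t))

  sides-visited : ∀ t → SidesVisited (suc t)
  sides-visited t = proj₂ (lap t (corner t))

  visited-side₁ : ∀ s i → i ≤ s → Visited (side₁ s i)
  visited-side₁ zero    zero _   = subst Visited (sym pt-origin) (0 , refl)
  visited-side₁ (suc t) i    i≤s = proj₁ (sides-visited t i i≤s)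

  visited-quadrant : ∀ a b → Visited (pt (+ a) (+ b))
  visited-quadrant a b = subst Visited (cong (λ x → pt x (+ b)) (x≡ (+ a) (+ b)))
                                 (visited-side₁ (a ℕ.+ b) b (ℕP.m≤n+m b a))
    where
    x≡ : ∀ A B → A ℤ.+ B ℤ.- B ≡ A
    x≡ = solve-∀

  visited-above-diagonal : ∀ x c → Visited (pt x (x ℤ.+ + c))
  visited-above-diagonal (+ a)    c = visited-quadrant a (a ℕ.+ c)
  visited-above-diagonal -[1+ a ] c =
    subst Visited (cong (pt -[1+ a ]) (y≡ (+ suc a) (+ c)))
          (proj₁ (proj₂ (sides-visited (a ℕ.+ c) (suc a) (s≤s (ℕP.m≤m+n a c)))))
    where
    y≡ : ∀ A C → A ℤ.+ C ℤ.- + 2 ℤ.* A ≡ ℤ.- A ℤ.+ C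
    y≡ = solve-∀

  visited-below-diagonal : ∀ y d → Visited (pt (y ℤ.+ + suc d) y)
  visited-below-diagonal (+ b)    d = visited-quadrant (b ℕ.+ suc d) b
  visited-below-diagonal -[1+ b ] d =
    subst Visited (cong₂ pt (x≡ (+ suc d) (+ suc b)) (y≡ (+ suc d) (+ suc b)))
          (proj₂ (proj₂ (sides-visited (d ℕ.+ suc b) (suc d)
                                       (s≤s (ℕP.m≤m+n d (suc b))))))
    where
    x≡ : ∀ D B → + 2 ℤ.* D ℤ.- (D ℤ.+ B) ≡ ℤ.- B ℤ.+ D
    x≡ = solve-∀
    y≡ : ∀ D B → D ℤ.- (D ℤ.+ B) ≡ ℤ.- B
    y≡ = solve-∀

  visited-diagonal-offset : ∀ x δ → Visited (pt x (x ℤ.+ δ))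
  visited-diagonal-offset x (+ c)    = visited-above-diagonal x c
  visited-diagonal-offset x -[1+ d ] =
    subst (λ x′ → Visited (pt x′ (x ℤ.+ -[1+ d ]))) (x≡ x (+ suc d))
          (visited-below-diagonal (x ℤ.+ -[1+ d ]) d)
    where
    x≡ : ∀ X D → X ℤ.- D ℤ.+ D ≡ X
    x≡ = solve-∀

  visited-everywhere : ∀ v → Visited v
  visited-everywhere (x , y) =
    subst Visited (cong₂ _,_ (+-diff (proj₁ O) x) (+-diff (proj₂ O) y))
          (subst (Visited ∘ pt x₀) (+-diff x₀ y₀)
                 (visited-diagonal-offset x₀ (y₀ ℤ.- x₀)))
    where
    +-diff : ∀ a b → a ℤ.+ (b ℤ.- a) ≡ b
    +-diff = solve-∀
    x₀ y₀ : ℤ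
    x₀ = x ℤ.- proj₁ O
    y₀ = y ℤ.- proj₂ O

theorem10 : (O : Node) (d₁ d₂ : Direction) → Large d₁ d₂
          → Σ (Automaton 3) (λ A → ExploresLargeFreeWedge A O d₁ d₂)
theorem10 O d₁ d₂ _ = explorer , λ v _ → visited-everywhere O v
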